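{- In the setting described in the context, for every $\mathcal{Q}\subseteq\mathcal{P}$ with $|\mathcal{Q}|=i$, the family $\mathcal{C}_i^{\mathcal{Q}}$ is a ring family.
   Context: Setting: $G=(V,E)$ an undirected (multi)graph with $E$ partitioned into safe edges $\mathcal{S}$ and unsafe edges $\mathcal{U}$, vertices $s\ne t$, integers $p\ge1$, $q\ge1$. $\delta_F(A)$ is the set of edges of $F$ with exactly one endpoint in $A$; an $s$-$t$ cut is $A\subseteq V$ with $s\in A$, $t\notin A$. Let $F\subseteq E$ be such that every $s$-$t$ cut $A$ has $|\delta_{F\cap\mathcal{S}}(A)|\ge p$ or $|\delta_F(A)|\ge p+q-1$, and such that, giving each safe edge capacity $p+q$ and each unsafe edge capacity $p$, every $s$-$t$ cut in $(V,F)$ has capacity at least $p(p+q)$. Fix $i\in\{0,\dots,p-1\}$ and $F_i\supseteq F$, $F_i\subseteq E$, such that every $s$-$t$ cut $A$ with $|\delta_{F_i}(A)|=p+q-1$ has $|\delta_{F_i\cap\mathcal{S}}(A)|\ge i$. Let $\mathcal{C}_i=\{A: s\in A,\ t\notin A,\ |\delta_{F_i}(A)|=p+q-1,\ |\delta_{F_i\cap\mathcal{S}}(A)|=i\}$. Take an integral maximum $s$-$t$ flow in $(V,F_i)$ with the capacities above and decompose it into a collection $\mathcal{P}$ of $s$-$t$ paths each carrying one unit of flow (paths viewed as edge sets). For $\mathcal{Q}=\{P_1,\dots,P_i\}\subseteq\mathcal{P}$, $\mathcal{C}_i^{\mathcal{Q}}$ is the set of $A\in\mathcal{C}_i$ for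 which there exist distinct safe edges $e_1,\dots,e_i$ with $\delta_{F_i}(A)\cap P_j=\{e_j\}$ for all $j\in[i]$ and $\delta_{F_i\cap\mathcal{S}}(A)=\{e_1,\dots,e_i\}$. A family $\mathcal{C}\subseteq2^V$ is uncrossable if for all $A,B\in\mathcal{C}$, either $A\cup B,A\cap B\in\mathcal{C}$ or $A\setminus B,B\setminus A\in\mathcal{C}$; it is a ring family if it is uncrossable, if whenever $A,B\in\mathcal{C}$ properly intersect (i.e., $A\cap B$, $A\setminus B$, $B\setminus A$ are all nonempty) then $A\cap B,A\cup B\in\mathcal{C}$, and if $\mathcal{C}$ has a unique minimal set. -}

module Defs where

open import Data.Nat using (ℕ; zero; suc; _+_; _*_; _∸_; _≤_; _<_)
open import Data.Bool using (Bool; true; false; _xor_; _∧_; if_then_else_)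
open import Data.Fin using (Fin; zero; suc; inject₁; fromℕ; _≟_)
open import Data.Fin.Subset using (Subset; _∈_; _∉_; _∩_; _∪_; _─_; _⊂_; ∣_∣; ⁅_⁆; Nonempty)
open import Data.Fin.Properties using (any?)
open import Data.Vec using (Vec; lookup; tabulate)
open import Data.List using (List; map; allFin)
open import Data.Nat.ListAction using (sum)
open import Data.Product using (Σ; _×_; _,_; ∃; proj₁; proj₂)
open import Data.Sum using (_⊎_)
open import Function.Definitions using (Injective)
open import Relation.Binary.PropositionalEquality using (_≡_; _≢_)
open import Relation.Nullary using (¬_)
open import Relation.Nullary.Decidable using (⌊_⌋)

-- Finite undirected multigraphs with vertex set Fin n, edge set Fin m.
-- Each edge has two endpoints; 'safe' is the set S of safe edges,
-- the unsafe edges U are the complement.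

record Graph : Set where
  field
    n    : ℕ
    m    : ℕ
    ends : Fin m → Fin n × Fin n
    safe : Subset m

module _ (G : Graph) where
  open Graph G

  VSet : Set
  VSet = Subset n

  ESet : Set
  ESet = Subset m

  crosses : VSet → Fin m → Bool
  crosses A e = lookup A (proj₁ (ends e)) xor lookup A (proj₂ (ends e))

  δ : ESet → VSet → ESet
  δ F A = tabulate (λ e → lookup F e ∧ crosses A e)

  IsCut : Fin n → Fin n → VSet → Set
  IsCut s t A = (s ∈ A) × (t ∉ A)

  cap : ℕ → ℕ → Fin m → ℕ
  cap p q e = if lookup safe e then p + q else p

  capSum : ℕ → ℕ → ESet → ℕ
  capSum p q D = sum (map (λ e → if lookup D e then cap p q e else 0) (allFin m))

  record Path (s t : Fin n) : Set where
    field
      len   : ℕ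
      verts : Fin (suc len) → Fin n
      edges : Fin len → Fin m
      simple : Injective _≡_ _≡_ verts
      start : verts zero ≡ s
      end   : verts (fromℕ len) ≡ t
      link  : ∀ j → (ends (edges j) ≡ (verts (inject₁ j) , verts (suc j)))
                  ⊎ (ends (edges j) ≡ (verts (suc j) , verts (inject₁ j)))

  edgeSet : ∀ {s t} → Path s t → ESet
  edgeSet P = tabulate (λ e → ⌊ any? (λ j → Path.edges P j ≟ e) ⌋)

  -- a finite collection (multiset) of k s-t paths, each using edges of F
  -- only, such that each edge e lies on at most cap(e) of the paths;
  -- i.e. an integral s-t flow in (V,F) decomposed into unit paths
  record PathFlow (p q : ℕ) (F : ESet) (s t : Fin n) : Set where
    field
      k     : ℕ
      paths : Fin k → Path s t
      inF   : ∀ j e → e ∈ edgeSet (paths j) → e ∈ F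
      load  : ∀ e → ∣ tabulate (λ j → lookup (edgeSet (paths j)) e) ∣ ≤ cap p q e

  -- maximum: no capacity-respecting path collection has more paths
  -- (its value k equals the maximum s-t flow value)
  IsMaximum : ∀ {p q F s t} → PathFlow p q F s t → Set
  IsMaximum {p} {q} {F} {s} {t} 𝒫 = ∀ (𝒫′ : PathFlow p q F s t) → PathFlow.k 𝒫′ ≤ PathFlow.k 𝒫

  Ci : ℕ → ℕ → ℕ → ESet → Fin n → Fin n → VSet → Set
  Ci p q i Fi s t A = IsCut s t A × (∣ δ Fi A ∣ ≡ p + q ∸ 1) × (∣ δ (Fi ∩ safe) A ∣ ≡ i)

  -- the family C_i^Q, for Q = {P_ι(1),...,P_ι(i)} given by i distinct
  -- indices ι into the path collection
  CiQ : ∀ {p q Fi s t} (i : ℕ) (𝒫 : PathFlow p q Fi s t)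
        → (Fin i → Fin (PathFlow.k 𝒫)) → VSet → Set
  CiQ {p} {q} {Fi} {s} {t} i 𝒫 ι A =
    Ci p q i Fi s t A ×
    Σ (Fin i → Fin m) (λ e →
        Injective _≡_ _≡_ e
      × (∀ j → e j ∈ safe)
      × (∀ j → δ Fi A ∩ edgeSet (PathFlow.paths 𝒫 (ι j)) ≡ ⁅ e j ⁆)
      × (δ (Fi ∩ safe) A ≡ tabulate (λ x → ⌊ any? (λ j → e j ≟ x) ⌋)))

Family : ℕ → Set₁
Family n = Subset n → Set

Uncrossable : ∀ {n} → Family n → Set
Uncrossable C = ∀ A B → C A → C B →
  (C (A ∪ B) × C (A ∩ B)) ⊎ (C (A ─ B) × C (B ─ A))

ProperlyIntersect : ∀ {n} → Subset n → Subset n → Set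
ProperlyIntersect A B = Nonempty (A ∩ B) × Nonempty (A ─ B) × Nonempty (B ─ A)

IsMinimal : ∀ {n} → Family n → Subset n → Set
IsMinimal C M = C M × (∀ B → C B → ¬ (B ⊂ M))

-- unique minimal set (read as: if the family is nonempty, it has exactly
-- one minimal member)
HasUniqueMinimal : ∀ {n} → Family n → Set
HasUniqueMinimal C = (∃ λ A → C A) →
  Σ (Subset _) (λ M → IsMinimal C M × (∀ M′ → IsMinimal C M′ → M′ ≡ M))

IsRingFamily : ∀ {n} → Family n → Set
IsRingFamily C =
    Uncrossable C
  × (∀ A B → C A → C B → ProperlyIntersect A B → C (A ∩ B) × C (A ∪ B))
  × HasUniqueMinimal C

-- For any edge set H the cut function A ↦ |δ_H(A)| is submodular, because an edge crossing
-- A ∩ B or A ∪ B crosses A or B, and an edge crossing both crosses both A and B.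
-- Let A, B ∈ C_i^Q with crossing edges e_j^A, e_j^B on the path P_j. Every F_i-edge of P_j
-- crossing A ∩ B is e_j^A or e_j^B, and if both crossed A ∩ B, the edge where P_j crosses A ∪ B
-- would be one of them and cross both A and B, forcing e_j^A = e_j^B. So P_j crosses A ∩ B in a
-- single edge, which is safe and differs for different j; likewise for A ∪ B. Hence both have at
-- least i safe cut edges, and submodularity makes it exactly i. As i < p, the cut condition on F
-- gives both at least p + q - 1 cut edges in F_i, and submodularity again makes it exactly p + q - 1.
-- Closure under ∩ and ∪ gives a ring family.

module Submission where

open import Defs
open import Data.Nat using (ℕ; zero; suc; _+_; _*_; _∸_; _≤_; _<_; z≤n; s≤s)
open import Data.Nat.Properties using (≤-trans; ≤-antisym; ≤-reflexive; +-suc; +-mono-≤; +-monoˡ-≤; +-monoʳ-≤; +-cancelˡ-≤; +-cancelʳ-≤; <⇒≱; ≤⇒≯; module ≤-Reasoning)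
import Data.Nat as ℕ
open import Data.Nat.Induction using (<-wellFounded)
import Data.Bool as Bool
open import Data.Bool using (Bool; true; false; T; T?; _∧_; _∨_; _xor_)
open import Data.Bool.Properties using (T-≡; T-∧)
open import Data.Fin using (Fin; zero; suc; inject₁; fromℕ; _≟_)
open import Data.Fin.Properties using (any?; all?; suc-injective; 0≢1+n)
open import Data.Fin.Subset using (Subset; inside; outside; _∈_; _∩_; _∪_; _⊆_; _⊂_; _-_; ∣_∣; ⁅_⁆)
open import Data.Fin.Subset.Properties using (_∈?_; _⊂?_; anySubset?; ⊆-antisym; p⊆q⇒∣p∣≤∣q∣; p⊂q⇒∣p∣<∣q∣; x∈⁅x⁆; x∈⁅y⁆⇒x≡y; x∈p∧x≢y⇒x∈p-y; x∈p⇒∣p-x∣<∣p∣; p∩q⊆p; x∈p∩q⁺; x∈p∩q⁻; x∈p∪q⁺; x∈p∪q⁻)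
open import Data.Vec using (_∷_; []; lookup; tabulate)
open import Data.Vec.Properties using (≡-dec; lookup∘tabulate; lookup-zipWith; []=⇒lookup; lookup⇒[]=)
open import Data.Product using (Σ; _×_; _,_; ∃; proj₁; proj₂; swap)
open import Data.Sum using (_⊎_; inj₁; inj₂; [_,_]′)
import Data.Sum as Sum
open import Function using (_∘_)
open import Function.Bundles using (Equivalence)
open import Function.Definitions using (Injective)
open import Induction.WellFounded using (WellFounded; Acc; acc; module Subrelation)
import Relation.Binary.Construct.On as On
open import Relation.Binary.PropositionalEquality using (_≡_; _≢_; refl; sym; trans; cong; cong₂; subst; module ≡-Reasoning)
open import Relation.Binary.Definitions using (DecidableEquality)
open import Relation.Nullary using (¬_; Dec; yes; no; contradiction)
open import Relation.Nullary.Decidable using (⌊_⌋; toWitness; fromWitness; _×-dec_; ¬?; map′; _→-dec_)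
open import Relation.Unary using (Decidable)

∣p∩q∣+∣p∪q∣≡∣p∣+∣q∣ : ∀ {n} (p q : Subset n) → ∣ p ∩ q ∣ + ∣ p ∪ q ∣ ≡ ∣ p ∣ + ∣ q ∣
∣p∩q∣+∣p∪q∣≡∣p∣+∣q∣ []            []            = refl
∣p∩q∣+∣p∪q∣≡∣p∣+∣q∣ (outside ∷ p) (outside ∷ q) = ∣p∩q∣+∣p∪q∣≡∣p∣+∣q∣ p q
∣p∩q∣+∣p∪q∣≡∣p∣+∣q∣ (outside ∷ p) (inside  ∷ q) = begin
  ∣ p ∩ q ∣ + suc ∣ p ∪ q ∣  ≡⟨ +-suc _ _ ⟩
  suc (∣ p ∩ q ∣ + ∣ p ∪ q ∣) ≡⟨ cong suc (∣p∩q∣+∣p∪q∣≡∣p∣+∣q∣ p q) ⟩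
  suc (∣ p ∣ + ∣ q ∣)         ≡⟨ +-suc _ _ ⟨
  ∣ p ∣ + suc ∣ q ∣           ∎
  where open ≡-Reasoning
∣p∩q∣+∣p∪q∣≡∣p∣+∣q∣ (inside  ∷ p) (outside ∷ q) =
  trans (+-suc _ _) (cong suc (∣p∩q∣+∣p∪q∣≡∣p∣+∣q∣ p q))
∣p∩q∣+∣p∪q∣≡∣p∣+∣q∣ (inside  ∷ p) (inside  ∷ q) = begin
  suc (∣ p ∩ q ∣ + suc ∣ p ∪ q ∣) ≡⟨ cong suc (+-suc _ _) ⟩
  suc (suc (∣ p ∩ q ∣ + ∣ p ∪ q ∣)) ≡⟨ cong (λ k → suc (suc k)) (∣p∩q∣+∣p∪q∣≡∣p∣+∣q∣ p q) ⟩
  suc (suc (∣ p ∣ + ∣ q ∣))         ≡⟨ cong suc (+-suc _ _) ⟨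
  suc (∣ p ∣ + suc ∣ q ∣)           ∎
  where open ≡-Reasoning

⊆∧∣⊇∣⇒≡ : ∀ {n} {p q : Subset n} → p ⊆ q → ∣ q ∣ ≤ ∣ p ∣ → p ≡ q
⊆∧∣⊇∣⇒≡ {p = p} p⊆q ∣q∣≤∣p∣ = ⊆-antisym p⊆q q⊆p
  where
  q⊆p : _ ⊆ p
  q⊆p {x} x∈q with x ∈? p
  ... | yes x∈p = x∈p
  ... | no  x∉p = contradiction (p⊂q⇒∣p∣<∣q∣ (p⊆q , x , x∈q , x∉p)) (≤⇒≯ ∣q∣≤∣p∣)

injective⇒≤∣p∣ : ∀ {i n} {f : Fin i → Fin n} (p : Subset n) →
                 Injective _≡_ _≡_ f → (∀ j → f j ∈ p) → i ≤ ∣ p ∣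
injective⇒≤∣p∣ {zero}  p _      _   = z≤n
injective⇒≤∣p∣ {suc i} {f = f} p f-inj f∈p = ≤-trans
  (s≤s (injective⇒≤∣p∣ (p - f zero) (suc-injective ∘ f-inj) f′∈p-f₀))
  (x∈p⇒∣p-x∣<∣p∣ (f∈p zero))
  where
  f′∈p-f₀ : ∀ j → f (suc j) ∈ p - f zero
  f′∈p-f₀ j = x∈p∧x≢y⇒x∈p-y (f∈p (suc j)) (0≢1+n ∘ sym ∘ f-inj)

⁅⁆-injective : ∀ {n} {x y : Fin n} → ⁅ x ⁆ ≡ ⁅ y ⁆ → x ≡ y
⁅⁆-injective {x = x} eq = x∈⁅y⁆⇒x≡y _ (subst (x ∈_) eq (x∈⁅x⁆ x))

p∩q≡⁅y⁆⇒x≡y : ∀ {n} {p q : Subset n} {x y} → p ∩ q ≡ ⁅ y ⁆ → x ∈ p → x ∈ q → x ≡ y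
p∩q≡⁅y⁆⇒x≡y {x = x} eq x∈p x∈q = x∈⁅y⁆⇒x≡y _ (subst (x ∈_) eq (x∈p∩q⁺ (x∈p , x∈q)))

unique-member⇒≡⁅⁆ : ∀ {n} {p : Subset n} {x} → x ∈ p → (∀ {y} → y ∈ p → y ≡ x) → p ≡ ⁅ x ⁆
unique-member⇒≡⁅⁆ {p = p} x∈p unique = ⊆-antisym
  (λ {y} y∈p → subst (λ z → y ∈ ⁅ z ⁆) (unique y∈p) (x∈⁅x⁆ y))
  (λ y∈⁅x⁆ → subst (_∈ p) (sym (x∈⁅y⁆⇒x≡y _ y∈⁅x⁆)) x∈p)

∈⇒T-lookup : ∀ {n} {p : Subset n} {x} → x ∈ p → T (lookup p x)
∈⇒T-lookup x∈p = Equivalence.from T-≡ ([]=⇒lookup x∈p)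

T-lookup⇒∈ : ∀ {n} {p : Subset n} {x} → T (lookup p x) → x ∈ p
T-lookup⇒∈ {p = p} {x} t = lookup⇒[]= x p (Equivalence.to T-≡ t)

∈-tabulate⁺ : ∀ {n} {g : Fin n → Bool} {x} → T (g x) → x ∈ tabulate g
∈-tabulate⁺ {g = g} {x} t = T-lookup⇒∈ (subst T (sym (lookup∘tabulate g x)) t)

∈-tabulate⁻ : ∀ {n} {g : Fin n → Bool} {x} → x ∈ tabulate g → T (g x)
∈-tabulate⁻ {g = g} {x} x∈ = subst T (lookup∘tabulate g x) (∈⇒T-lookup x∈)

image : ∀ {i n} → (Fin i → Fin n) → Subset n
image f = tabulate (λ x → ⌊ any? (λ j → f j ≟ x) ⌋)

f∈image : ∀ {i n} (f : Fin i → Fin n) j → f j ∈ image f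
f∈image f j = ∈-tabulate⁺ (fromWitness (j , refl))

image⊆ : ∀ {i n} {f : Fin i → Fin n} {p} → (∀ j → f j ∈ p) → image f ⊆ p
image⊆ f∈p x∈ with toWitness (∈-tabulate⁻ x∈)
... | j , refl = f∈p j

image-cong : ∀ {i n} {f g : Fin i → Fin n} → (∀ j → f j ≡ g j) → image f ≡ image g
image-cong {f = f} {g} f≗g = ⊆-antisym
  (image⊆ (λ j → subst (_∈ image g) (sym (f≗g j)) (f∈image g j)))
  (image⊆ (λ j → subst (_∈ image f) (f≗g j) (f∈image f j)))

injective⇒≤∣image∣ : ∀ {i n} {f : Fin i → Fin n} → Injective _≡_ _≡_ f → i ≤ ∣ image f ∣
injective⇒≤∣image∣ {f = f} f-inj = injective⇒≤∣p∣ (image f) f-inj (f∈image f)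

infix 4 _≟ₛ_
_≟ₛ_ : ∀ {n} → DecidableEquality (Subset n)
_≟ₛ_ = ≡-dec Bool._≟_

injective? : ∀ {i n} (f : Fin i → Fin n) → Dec (Injective _≡_ _≡_ f)
injective? f = map′ (λ inj {x} {y} → inj x y) (λ inj x y → inj)
                    (all? λ x → all? λ y → f x ≟ f y →-dec x ≟ y)

squeeze : ∀ {k a b} → k ≤ a → k ≤ b → a + b ≤ k + k → a ≡ k × b ≡ k
squeeze {k} {a} {b} k≤a k≤b a+b≤k+k =
    ≤-antisym (+-cancelʳ-≤ k a k (≤-trans (+-monoʳ-≤ a k≤b) a+b≤k+k)) k≤a
  , ≤-antisym (+-cancelˡ-≤ k b k (≤-trans (+-monoˡ-≤ b k≤a) a+b≤k+k)) k≤b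

⊂-wellFounded : ∀ {n} → WellFounded (_⊂_ {n})
⊂-wellFounded = Subrelation.wellFounded p⊂q⇒∣p∣<∣q∣ (On.wellFounded ∣_∣ <-wellFounded)

module _ {n} {C : Family n} where

  minimal-below : Decidable C → ∀ {A} → Acc _⊂_ A → C A → ∃ (IsMinimal C)
  minimal-below C? {A} (acc smaller) A∈C with anySubset? (λ B → C? B ×-dec B ⊂? A)
  ... | yes (B , B∈C , B⊂A) = minimal-below C? (smaller B⊂A) B∈C
  ... | no  ∄B              = A , A∈C , λ B B∈C B⊂A → ∄B (B , B∈C , B⊂A)

  minimal⇒least : (∀ {A B} → C A → C B → C (A ∩ B)) →
                  ∀ {M A} → IsMinimal C M → C A → M ⊆ A
  minimal⇒least ∩-closed {M} {A} (M∈C , M-minimal) A∈C {x} x∈M with x ∈? A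
  ... | yes x∈A = x∈A
  ... | no  x∉A = contradiction M∩A⊂M (M-minimal (M ∩ A) (∩-closed M∈C A∈C))
    where
    M∩A⊂M : M ∩ A ⊂ M
    M∩A⊂M = p∩q⊆p M A , x , x∈M , x∉A ∘ proj₂ ∘ x∈p∩q⁻ M A

  ∩-closed⇒hasUniqueMinimal : Decidable C → (∀ {A B} → C A → C B → C (A ∩ B)) → HasUniqueMinimal C
  ∩-closed⇒hasUniqueMinimal C? ∩-closed (A , A∈C) with minimal-below C? (⊂-wellFounded A) A∈C
  ... | M , M-minimal = M , M-minimal , λ M′ M′-minimal →
    ⊆-antisym (minimal⇒least ∩-closed M′-minimal (proj₁ M-minimal))
              (minimal⇒least ∩-closed M-minimal (proj₁ M′-minimal))

  ∩∪-closed⇒isRingFamily : Decidable C → (∀ {A B} → C A → C B → C (A ∩ B) × C (A ∪ B)) → IsRingFamily C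
  ∩∪-closed⇒isRingFamily C? closed =
      (λ _ _ A∈C B∈C → inj₁ (swap (closed A∈C B∈C)))
    , (λ _ _ A∈C B∈C _ → closed A∈C B∈C)
    , ∩-closed⇒hasUniqueMinimal C? (λ A∈C B∈C → proj₁ (closed A∈C B∈C))

xor-∧⇒ : ∀ a b c d → T ((a ∧ b) xor (c ∧ d)) → T (a xor c) ⊎ T (b xor d)
xor-∧⇒ true  _ true  _ h  = inj₂ h
xor-∧⇒ true  _ false _ _  = inj₁ _
xor-∧⇒ false _ true  _ _  = inj₁ _
xor-∧⇒ false _ false _ ()

xor-∨⇒ : ∀ a b c d → T ((a ∨ b) xor (c ∨ d)) → T (a xor c) ⊎ T (b xor d)
xor-∨⇒ true  _ true  _ ()
xor-∨⇒ true  _ false _ _ = inj₁ _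
xor-∨⇒ false _ true  _ _ = inj₁ _
xor-∨⇒ false _ false _ h = inj₂ h

xor-∧×xor-∨⇒ : ∀ a b c d → T ((a ∧ b) xor (c ∧ d)) → T ((a ∨ b) xor (c ∨ d)) → T (a xor c) × T (b xor d)
xor-∧×xor-∨⇒ true  true  false false _ _ = _ , _
xor-∧×xor-∨⇒ false false true  true  _ _ = _ , _
xor-∧×xor-∨⇒ true  false false _     () _
xor-∧×xor-∨⇒ true  true  false true  _ ()
xor-∧×xor-∨⇒ false _     true  false () _
xor-∧×xor-∨⇒ false true  true  true  _ ()
xor-∧×xor-∨⇒ true  _     true  _     _ ()
xor-∧×xor-∨⇒ false _     false _     () _

T-xor⁺ : ∀ {a b} → T a → ¬ T b → T (a xor b) × T (b xor a)
T-xor⁺ {true} {false} _ _  = _ , _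
T-xor⁺ {true} {true}  _ ¬b = contradiction _ ¬b

true→false-step : ∀ L (f : Fin (suc L) → Bool) → T (f zero) → ¬ T (f (fromℕ L)) →
                  ∃ λ j → T (f (inject₁ j)) × ¬ T (f (suc j))
true→false-step zero    f f₀ ¬f₀ = contradiction f₀ ¬f₀
true→false-step (suc L) f f₀ ¬fₗ with T? (f (suc zero))
... | no  ¬f₁ = zero , f₀ , ¬f₁
... | yes f₁ with true→false-step L (f ∘ suc) f₁ ¬fₗ
...   | j , fⱼ , ¬fⱼ₊₁ = suc j , fⱼ , ¬fⱼ₊₁

module Cuts (G : Graph) where
  open Graph G

  ∈δ⁺ : ∀ {H} Z {e} → e ∈ H → T (crosses G Z e) → e ∈ δ G H Z
  ∈δ⁺ _ e∈H e-crosses = ∈-tabulate⁺ (Equivalence.from T-∧ (∈⇒T-lookup e∈H , e-crosses))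

  ∈δ⁻ : ∀ H Z {e} → e ∈ δ G H Z → e ∈ H × T (crosses G Z e)
  ∈δ⁻ _ _ e∈δ with Equivalence.to T-∧ (∈-tabulate⁻ e∈δ)
  ... | e∈H , e-crosses = T-lookup⇒∈ e∈H , e-crosses

  δ-mono : ∀ {H H′} Z → H ⊆ H′ → δ G H Z ⊆ δ G H′ Z
  δ-mono {H} Z H⊆H′ e∈δ with ∈δ⁻ H Z e∈δ
  ... | e∈H , e-crosses = ∈δ⁺ Z (H⊆H′ e∈H) e-crosses

  module _ (A B : Subset n) (e : Fin m) where
    private
      u = proj₁ (ends e)
      v = proj₂ (ends e)

      crosses-∩ : crosses G (A ∩ B) e ≡ (lookup A u ∧ lookup B u) xor (lookup A v ∧ lookup B v)
      crosses-∩ = cong₂ _xor_ (lookup-zipWith _∧_ u A B) (lookup-zipWith _∧_ v A B)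

      crosses-∪ : crosses G (A ∪ B) e ≡ (lookup A u ∨ lookup B u) xor (lookup A v ∨ lookup B v)
      crosses-∪ = cong₂ _xor_ (lookup-zipWith _∨_ u A B) (lookup-zipWith _∨_ v A B)

    crosses-∩⇒ : T (crosses G (A ∩ B) e) → T (crosses G A e) ⊎ T (crosses G B e)
    crosses-∩⇒ = xor-∧⇒ (lookup A u) (lookup B u) (lookup A v) (lookup B v) ∘ subst T crosses-∩

    crosses-∪⇒ : T (crosses G (A ∪ B) e) → T (crosses G A e) ⊎ T (crosses G B e)
    crosses-∪⇒ = xor-∨⇒ (lookup A u) (lookup B u) (lookup A v) (lookup B v) ∘ subst T crosses-∪

    crosses-∩×∪⇒ : T (crosses G (A ∩ B) e) → T (crosses G (A ∪ B) e) → T (crosses G A e) × T (crosses G B e)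
    crosses-∩×∪⇒ c∩ c∪ = xor-∧×xor-∨⇒ (lookup A u) (lookup B u) (lookup A v) (lookup B v)
      (subst T crosses-∩ c∩) (subst T crosses-∪ c∪)

  module _ {H : Subset m} {A B : Subset n} where

    private
      ∈δ∪δ⁺ : ∀ {e} → e ∈ H → T (crosses G A e) ⊎ T (crosses G B e) → e ∈ δ G H A ∪ δ G H B
      ∈δ∪δ⁺ e∈H = x∈p∪q⁺ ∘ Sum.map (∈δ⁺ A e∈H) (∈δ⁺ B e∈H)

    δ-∩⊆ : δ G H (A ∩ B) ⊆ δ G H A ∪ δ G H B
    δ-∩⊆ e∈δ with ∈δ⁻ H (A ∩ B) e∈δ
    ... | e∈H , crosses-A∩B = ∈δ∪δ⁺ e∈H (crosses-∩⇒ A B _ crosses-A∩B)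

    δ-∪⊆ : δ G H (A ∪ B) ⊆ δ G H A ∪ δ G H B
    δ-∪⊆ e∈δ with ∈δ⁻ H (A ∪ B) e∈δ
    ... | e∈H , crosses-A∪B = ∈δ∪δ⁺ e∈H (crosses-∪⇒ A B _ crosses-A∪B)

    δ-∩∩∪⊆ : δ G H (A ∩ B) ∩ δ G H (A ∪ B) ⊆ δ G H A ∩ δ G H B
    δ-∩∩∪⊆ {e} e∈ with x∈p∩q⁻ (δ G H (A ∩ B)) _ e∈
    ... | e∈δ∩ , e∈δ∪ with ∈δ⁻ H (A ∩ B) e∈δ∩ | ∈δ⁻ H (A ∪ B) e∈δ∪
    ...   | e∈H , crosses-A∩B | _ , crosses-A∪B with crosses-∩×∪⇒ A B e crosses-A∩B crosses-A∪B
    ...     | crosses-A , crosses-B = x∈p∩q⁺ (∈δ⁺ A e∈H crosses-A , ∈δ⁺ B e∈H crosses-B)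

    δ-submodular : ∣ δ G H (A ∩ B) ∣ + ∣ δ G H (A ∪ B) ∣ ≤ ∣ δ G H A ∣ + ∣ δ G H B ∣
    δ-submodular = begin
      ∣ δ G H (A ∩ B) ∣ + ∣ δ G H (A ∪ B) ∣                         ≡⟨ ∣p∩q∣+∣p∪q∣≡∣p∣+∣q∣ (δ G H (A ∩ B)) (δ G H (A ∪ B)) ⟨
      ∣ δ G H (A ∩ B) ∩ δ G H (A ∪ B) ∣ + ∣ δ G H (A ∩ B) ∪ δ G H (A ∪ B) ∣
        ≤⟨ +-mono-≤ (p⊆q⇒∣p∣≤∣q∣ δ-∩∩∪⊆) (p⊆q⇒∣p∣≤∣q∣ λ e∈ → [ δ-∩⊆ , δ-∪⊆ ]′ (x∈p∪q⁻ (δ G H (A ∩ B)) _ e∈)) ⟩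
      ∣ δ G H A ∩ δ G H B ∣ + ∣ δ G H A ∪ δ G H B ∣                 ≡⟨ ∣p∩q∣+∣p∪q∣≡∣p∣+∣q∣ (δ G H A) (δ G H B) ⟩
      ∣ δ G H A ∣ + ∣ δ G H B ∣                                     ∎
      where open ≤-Reasoning

  ∩-isCut : ∀ {s t A B} → IsCut G s t A → IsCut G s t B → IsCut G s t (A ∩ B)
  ∩-isCut {A = A} {B} (s∈A , t∉A) (s∈B , _) = x∈p∩q⁺ (s∈A , s∈B) , t∉A ∘ proj₁ ∘ x∈p∩q⁻ A B

  ∪-isCut : ∀ {s t A B} → IsCut G s t A → IsCut G s t B → IsCut G s t (A ∪ B)
  ∪-isCut {A = A} {B} (s∈A , t∉A) (_ , t∉B) = x∈p∪q⁺ (inj₁ s∈A) , [ t∉A , t∉B ]′ ∘ x∈p∪q⁻ A B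

  crosses-link : ∀ A {e u v} → ends e ≡ (u , v) ⊎ ends e ≡ (v , u) →
                 T (lookup A u) → ¬ T (lookup A v) → T (crosses G A e)
  crosses-link _ (inj₁ refl) u∈A v∉A = proj₁ (T-xor⁺ u∈A v∉A)
  crosses-link _ (inj₂ refl) u∈A v∉A = proj₂ (T-xor⁺ u∈A v∉A)

  path-crosses-cut : ∀ {s t A} → IsCut G s t A → (P : Path G s t) →
                     ∃ λ e → e ∈ edgeSet G P × T (crosses G A e)
  path-crosses-cut {A = A} (s∈A , t∉A) P with true→false-step len (lookup A ∘ verts) starts-in ends-out
    where
    open Path P
    starts-in : T (lookup A (verts zero))
    starts-in = subst (T ∘ lookup A) (sym start) (∈⇒T-lookup s∈A)
    ends-out : ¬ T (lookup A (verts (fromℕ len)))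
    ends-out = t∉A ∘ T-lookup⇒∈ ∘ subst (T ∘ lookup A) end
  ... | j , u∈A , v∉A = Path.edges P j , f∈image (Path.edges P) j , crosses-link A (Path.link P j) u∈A v∉A

module _ {G : Graph} {p q Fi s t} (𝒫 : PathFlow G p q Fi s t) {i} (ι : Fin i → Fin (PathFlow.k 𝒫)) where
  open Graph G
  open Cuts G
  open PathFlow 𝒫 using (paths; inF)

  Q : Fin i → Subset m
  Q j = edgeSet G (paths (ι j))

  CrossedOnceAt : Subset n → (Fin i → Fin m) → Set
  CrossedOnceAt X e = ∀ j → δ G Fi X ∩ Q j ≡ ⁅ e j ⁆

  Crossings : Subset n → Set
  Crossings X = Σ (Fin i → Fin m) λ e → Injective _≡_ _≡_ e × (∀ j → e j ∈ safe) × CrossedOnceAt X e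

  -- Definitionally the second component of CiQ.
  ExactCrossings : Subset n → Set
  ExactCrossings X = Σ (Fin i → Fin m) λ e →
    Injective _≡_ _≡_ e × (∀ j → e j ∈ safe) × CrossedOnceAt X e × δ G (Fi ∩ safe) X ≡ image e

  path-meets-cut : ∀ {Z} → IsCut G s t Z → ∀ j → ∃ λ e → e ∈ δ G Fi Z × e ∈ Q j
  path-meets-cut {Z} cut j with path-crosses-cut cut (paths (ι j))
  ... | e , e∈Q , e-crosses = e , ∈δ⁺ Z (inF (ι j) e e∈Q) e-crosses , e∈Q

  shared-crossing⇒same-path : ∀ {X e} → Injective _≡_ _≡_ e → CrossedOnceAt X e →
                              ∀ {x j k} → x ∈ δ G Fi X → x ∈ Q j → x ∈ Q k → j ≡ k
  shared-crossing⇒same-path e-inj once x∈δ x∈Qj x∈Qk =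
    e-inj (trans (sym (p∩q≡⁅y⁆⇒x≡y (once _) x∈δ x∈Qj)) (p∩q≡⁅y⁆⇒x≡y (once _) x∈δ x∈Qk))

  module Uncrossing {A B Z Z′ : Subset n} {eA eB : Fin i → Fin m}
    (onceA : CrossedOnceAt A eA) (onceB : CrossedOnceAt B eB)
    (Z⊆ : δ G Fi Z ⊆ δ G Fi A ∪ δ G Fi B) (Z′⊆ : δ G Fi Z′ ⊆ δ G Fi A ∪ δ G Fi B)
    (Z∩Z′⊆ : δ G Fi Z ∩ δ G Fi Z′ ⊆ δ G Fi A ∩ δ G Fi B) (cutZ′ : IsCut G s t Z′) where

    crossing-of-A-or-B : ∀ {j x} → x ∈ δ G Fi A ∪ δ G Fi B → x ∈ Q j → x ≡ eA j ⊎ x ≡ eB j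
    crossing-of-A-or-B x∈δ x∈Q = Sum.map
      (λ x∈δA → p∩q≡⁅y⁆⇒x≡y (onceA _) x∈δA x∈Q)
      (λ x∈δB → p∩q≡⁅y⁆⇒x≡y (onceB _) x∈δB x∈Q)
      (x∈p∪q⁻ (δ G Fi A) _ x∈δ)

    crossings-agree : ∀ {j} → eA j ∈ δ G Fi Z → eB j ∈ δ G Fi Z → eA j ≡ eB j
    crossings-agree {j} eA∈δZ eB∈δZ =
      let c , c∈δZ′ , c∈Q = path-meets-cut cutZ′ j
          c∈δZ = [ (λ c≡eA → subst (_∈ δ G Fi Z) (sym c≡eA) eA∈δZ)
                 , (λ c≡eB → subst (_∈ δ G Fi Z) (sym c≡eB) eB∈δZ)
                 ]′ (crossing-of-A-or-B (Z′⊆ c∈δZ′) c∈Q)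
          c∈δA , c∈δB = x∈p∩q⁻ (δ G Fi A) _ (Z∩Z′⊆ (x∈p∩q⁺ (c∈δZ , c∈δZ′)))
      in trans (sym (p∩q≡⁅y⁆⇒x≡y (onceA j) c∈δA c∈Q)) (p∩q≡⁅y⁆⇒x≡y (onceB j) c∈δB c∈Q)

    crossing-unique : ∀ {j x y} → x ∈ δ G Fi Z → x ∈ Q j → y ∈ δ G Fi Z → y ∈ Q j → x ≡ y
    crossing-unique x∈δ x∈Q y∈δ y∈Q with crossing-of-A-or-B (Z⊆ x∈δ) x∈Q | crossing-of-A-or-B (Z⊆ y∈δ) y∈Q
    ... | inj₁ refl | inj₁ refl = refl
    ... | inj₂ refl | inj₂ refl = refl
    ... | inj₁ refl | inj₂ refl = crossings-agree x∈δ y∈δ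
    ... | inj₂ refl | inj₁ refl = sym (crossings-agree y∈δ x∈δ)

  uncrossed-crossings : ∀ {A B Z Z′} → ExactCrossings A → ExactCrossings B → IsCut G s t Z → IsCut G s t Z′ →
                        δ G Fi Z ⊆ δ G Fi A ∪ δ G Fi B → δ G Fi Z′ ⊆ δ G Fi A ∪ δ G Fi B →
                        δ G Fi Z ∩ δ G Fi Z′ ⊆ δ G Fi A ∩ δ G Fi B → Crossings Z
  uncrossed-crossings {A} {B} {Z} (eA , eA-inj , eA-safe , onceA , _) (eB , eB-inj , eB-safe , onceB , _)
                      cutZ cutZ′ Z⊆ Z′⊆ Z∩Z′⊆ = f , f-injective , f-safe , f-once
    where
    open Uncrossing {A} {B} {Z} onceA onceB Z⊆ Z′⊆ Z∩Z′⊆ cutZ′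

    f : Fin i → Fin m
    f j = proj₁ (path-meets-cut cutZ j)

    f∈δZ : ∀ j → f j ∈ δ G Fi Z
    f∈δZ j = proj₁ (proj₂ (path-meets-cut cutZ j))

    f∈Q : ∀ j → f j ∈ Q j
    f∈Q j = proj₂ (proj₂ (path-meets-cut cutZ j))

    f-once : CrossedOnceAt Z f
    f-once j = unique-member⇒≡⁅⁆ (x∈p∩q⁺ (f∈δZ j , f∈Q j)) λ y∈ →
      let y∈δZ , y∈Q = x∈p∩q⁻ (δ G Fi Z) _ y∈ in crossing-unique y∈δZ y∈Q (f∈δZ j) (f∈Q j)

    f-safe : ∀ j → f j ∈ safe
    f-safe j = [ (λ fj≡eA → subst (_∈ safe) (sym fj≡eA) (eA-safe j))
               , (λ fj≡eB → subst (_∈ safe) (sym fj≡eB) (eB-safe j))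
               ]′ (crossing-of-A-or-B (Z⊆ (f∈δZ j)) (f∈Q j))

    f-injective : Injective _≡_ _≡_ f
    f-injective {j} {k} fj≡fk =
      [ (λ fj∈δA → shared-crossing⇒same-path {A} eA-inj onceA fj∈δA (f∈Q j) fj∈Qk)
      , (λ fj∈δB → shared-crossing⇒same-path {B} eB-inj onceB fj∈δB (f∈Q j) fj∈Qk)
      ]′ (x∈p∪q⁻ (δ G Fi A) _ (Z⊆ (f∈δZ j)))
      where
      fj∈Qk : f j ∈ Q k
      fj∈Qk = subst (_∈ Q k) (sym fj≡fk) (f∈Q k)

  safe-crossings⊆δ-safe : ∀ Z {e} → (∀ j → e j ∈ safe) → CrossedOnceAt Z e → image e ⊆ δ G (Fi ∩ safe) Z
  safe-crossings⊆δ-safe Z {e} e-safe once = image⊆ λ j →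
    let ej∈δZ , _         = x∈p∩q⁻ (δ G Fi Z) _ (subst (e j ∈_) (sym (once j)) (x∈⁅x⁆ (e j)))
        ej∈Fi , ej-crosses = ∈δ⁻ Fi Z ej∈δZ
    in ∈δ⁺ Z (x∈p∩q⁺ (ej∈Fi , e-safe j)) ej-crosses

  crossings⇒i≤∣δ-safe∣ : ∀ Z → Crossings Z → i ≤ ∣ δ G (Fi ∩ safe) Z ∣
  crossings⇒i≤∣δ-safe∣ Z (e , e-inj , e-safe , once) =
    ≤-trans (injective⇒≤∣image∣ e-inj) (p⊆q⇒∣p∣≤∣q∣ (safe-crossings⊆δ-safe Z e-safe once))

  crossings⇒exact : ∀ Z → Crossings Z → ∣ δ G (Fi ∩ safe) Z ∣ ≤ i → ExactCrossings Z
  crossings⇒exact Z (e , e-inj , e-safe , once) ∣δ-safe∣≤i = e , e-inj , e-safe , once ,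
    sym (⊆∧∣⊇∣⇒≡ (safe-crossings⊆δ-safe Z e-safe once) (≤-trans ∣δ-safe∣≤i (injective⇒≤∣image∣ e-inj)))

  -- Each crossing edge is forced to be the unique element of δ_{F_i}(X) ∩ P_j, so it suffices to test that candidate.
  exactCrossings? : Decidable ExactCrossings
  exactCrossings? X with all? (λ j → any? (λ x → δ G Fi X ∩ Q j ≟ₛ ⁅ x ⁆))
  ... | no ¬once = no λ (e , _ , _ , once , _) → ¬once (λ j → e j , once j)
  ... | yes once₀ = map′ (λ (inj , safe′ , exact) → e₀ , inj , safe′ , proj₂ ∘ once₀ , exact) forced
      (injective? e₀ ×-dec all? (λ j → e₀ j ∈? safe) ×-dec δ G (Fi ∩ safe) X ≟ₛ image e₀)
    where
    e₀ : Fin i → Fin m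
    e₀ = proj₁ ∘ once₀

    forced : ExactCrossings X → Injective _≡_ _≡_ e₀ × (∀ j → e₀ j ∈ safe) × δ G (Fi ∩ safe) X ≡ image e₀
    forced (e , e-inj , e-safe , once , exact) =
        (λ eq → e-inj (trans (e≗e₀ _) (trans eq (sym (e≗e₀ _)))))
      , (λ j → subst (_∈ safe) (e≗e₀ j) (e-safe j))
      , trans exact (image-cong e≗e₀)
      where
      e≗e₀ : ∀ j → e j ≡ e₀ j
      e≗e₀ j = ⁅⁆-injective (trans (sym (once j)) (proj₂ (once₀ j)))

  CiQ? : Decidable (CiQ G i 𝒫 ι)
  CiQ? X = ((s ∈? X ×-dec ¬? (t ∈? X)) ×-dec ∣ δ G Fi X ∣ ℕ.≟ p + q ∸ 1 ×-dec ∣ δ G (Fi ∩ safe) X ∣ ℕ.≟ i)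
           ×-dec exactCrossings? X

  module _ {F : Subset m} (cut-condition : ∀ A → IsCut G s t A → p ≤ ∣ δ G (F ∩ safe) A ∣ ⊎ p + q ∸ 1 ≤ ∣ δ G F A ∣)
           (i<p : i < p) (F⊆Fi : F ⊆ Fi) where

    ∣δ-safe∣≤i⇒p+q∸1≤∣δ∣ : ∀ {Z} → IsCut G s t Z → ∣ δ G (Fi ∩ safe) Z ∣ ≤ i → p + q ∸ 1 ≤ ∣ δ G Fi Z ∣
    ∣δ-safe∣≤i⇒p+q∸1≤∣δ∣ {Z} cut ∣δ-safe∣≤i =
      [ (λ p≤ → contradiction (≤-trans p≤ (≤-trans (p⊆q⇒∣p∣≤∣q∣ (δ-mono Z F∩S⊆Fi∩S)) ∣δ-safe∣≤i)) (<⇒≱ i<p))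
      , (λ p+q-1≤ → ≤-trans p+q-1≤ (p⊆q⇒∣p∣≤∣q∣ (δ-mono Z F⊆Fi)))
      ]′ (cut-condition Z cut)
      where
      F∩S⊆Fi∩S : F ∩ safe ⊆ Fi ∩ safe
      F∩S⊆Fi∩S x∈ = let x∈F , x∈S = x∈p∩q⁻ F safe x∈ in x∈p∩q⁺ (F⊆Fi x∈F , x∈S)

    CiQ-∩∪-closed : ∀ {A B} → CiQ G i 𝒫 ι A → CiQ G i 𝒫 ι B → CiQ G i 𝒫 ι (A ∩ B) × CiQ G i 𝒫 ι (A ∪ B)
    CiQ-∩∪-closed {A} {B} ((cutA , ∣δA∣ , ∣δ-safe-A∣) , exactA) ((cutB , ∣δB∣ , ∣δ-safe-B∣) , exactB) =
        ((cutX , proj₁ sizes , proj₁ safe-sizes) , crossings⇒exact X crX (≤-reflexive (proj₁ safe-sizes)))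
      , ((cutY , proj₂ sizes , proj₂ safe-sizes) , crossings⇒exact Y crY (≤-reflexive (proj₂ safe-sizes)))
      where
      X = A ∩ B
      Y = A ∪ B
      cutX = ∩-isCut cutA cutB
      cutY = ∪-isCut cutA cutB

      crX : Crossings X
      crX = uncrossed-crossings {A} {B} {X} {Y} exactA exactB cutX cutY
        (δ-∩⊆ {Fi} {A} {B}) (δ-∪⊆ {Fi} {A} {B}) (δ-∩∩∪⊆ {Fi} {A} {B})
      crY : Crossings Y
      crY = uncrossed-crossings {A} {B} {Y} {X} exactA exactB cutY cutX
        (δ-∪⊆ {Fi} {A} {B}) (δ-∩⊆ {Fi} {A} {B}) (δ-∩∩∪⊆ {Fi} {A} {B} ∘ x∈p∩q⁺ ∘ swap ∘ x∈p∩q⁻ (δ G Fi Y) _)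

      safe-sizes : ∣ δ G (Fi ∩ safe) X ∣ ≡ i × ∣ δ G (Fi ∩ safe) Y ∣ ≡ i
      safe-sizes = squeeze (crossings⇒i≤∣δ-safe∣ X crX) (crossings⇒i≤∣δ-safe∣ Y crY)
        (≤-trans (δ-submodular {Fi ∩ safe} {A} {B}) (≤-reflexive (cong₂ _+_ ∣δ-safe-A∣ ∣δ-safe-B∣)))

      sizes : ∣ δ G Fi X ∣ ≡ p + q ∸ 1 × ∣ δ G Fi Y ∣ ≡ p + q ∸ 1
      sizes = squeeze (∣δ-safe∣≤i⇒p+q∸1≤∣δ∣ cutX (≤-reflexive (proj₁ safe-sizes)))
                      (∣δ-safe∣≤i⇒p+q∸1≤∣δ∣ cutY (≤-reflexive (proj₂ safe-sizes)))
        (≤-trans (δ-submodular {Fi} {A} {B}) (≤-reflexive (cong₂ _+_ ∣δA∣ ∣δB∣)))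

lemma3p10 : (G : Graph) (s t : Fin (Graph.n G)) (p q : ℕ) → s ≢ t → 1 ≤ p → 1 ≤ q →
    (F : Subset (Graph.m G)) →
    (∀ A → IsCut G s t A →
      (p ≤ ∣ δ G (F ∩ Graph.safe G) A ∣) ⊎ (p + q ∸ 1 ≤ ∣ δ G F A ∣)) →
    (∀ A → IsCut G s t A → p * (p + q) ≤ capSum G p q (δ G F A)) →
    (i : ℕ) → i < p →
    (Fi : Subset (Graph.m G)) → F ⊆ Fi →
    (∀ A → IsCut G s t A → ∣ δ G Fi A ∣ ≡ p + q ∸ 1 → i ≤ ∣ δ G (Fi ∩ Graph.safe G) A ∣) →
    (𝒫 : PathFlow G p q Fi s t) → IsMaximum G 𝒫 →
    (ι : Fin i → Fin (PathFlow.k 𝒫)) → Injective _≡_ _≡_ ι →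
    IsRingFamily (CiQ G i 𝒫 ι)
lemma3p10 G s t p q _ _ _ F cut-condition _ i i<p Fi F⊆Fi _ 𝒫 _ ι _ =
  ∩∪-closed⇒isRingFamily (CiQ? 𝒫 ι) (CiQ-∩∪-closed 𝒫 ι cut-condition i<p F⊆Fi)
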